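{- Let $2 \le k \le n$ and let $g = g(n,k)$. Suppose there exists a ${\rm PSCA}(n,k,\lambda)$ for each $\lambda \in \{g, g+1, \dots, 2g-1\}$. Then for a positive integer $\lambda$ there exists a ${\rm PSCA}(n,k,\lambda)$ if and only if $\lambda \ge g$; consequently, for every $\lambda$, the existence of a ${\rm PSCA}(n,k,\lambda)$ implies the existence of a ${\rm PSCA}(n,k,\lambda+1)$.
   Context: $S_n$ is the set of permutations of $[n]=\{1,\dots,n\}$, each regarded as the sequence of its values, and $S_{n,k}$ is the set of sequences of $k$ distinct elements of $[n]$. A sequence $x \in S_n$ covers $y \in S_{n,k}$ if $y$ is a (not necessarily contiguous) subsequence of $x$. A ${\rm PSCA}(n,k,\lambda)$ is a multiset $P$ of elements of $S_n$ such that every $y \in S_{n,k}$ is covered by exactly $\lambda$ elements of $P$, counted with multiplicity. $g(n,k)$ is the smallest positive integer $\lambda$ for which a ${\rm PSCA}(n,k,\lambda)$ exists. -}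

module Defs where

open import Data.Nat using (ℕ; suc; _<_; _≤_)
open import Data.Fin using (Fin; _≟_)
open import Data.Fin.Permutation using (Permutation′; _⟨$⟩ʳ_)
open import Data.List using (List; tabulate; length; filter)
open import Data.List.Relation.Unary.Unique.Propositional using (Unique)
open import Data.List.Relation.Binary.Sublist.Propositional using (_⊆_)
import Data.List.Relation.Binary.Sublist.DecPropositional as DecSub
open import Data.Product using (Σ; _×_)
open import Relation.Binary.PropositionalEquality using (_≡_)

sequence : ∀ {n} → Permutation′ n → List (Fin n)
sequence π = tabulate (π ⟨$⟩ʳ_)

IsKSeq : (n k : ℕ) → List (Fin n) → Set
IsKSeq n k y = Unique y × length y ≡ k

Covers : ∀ {n} → Permutation′ n → List (Fin n) → Set
Covers x y = y ⊆ sequence x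

-- Number of elements of the multiset P (a list, counted with multiplicity) covering y.
coverCount : ∀ {n} → List (Permutation′ n) → List (Fin n) → ℕ
coverCount {n} P y = length (filter (λ x → y ⊆? sequence x) P)
  where open DecSub {A = Fin n} _≟_ using (_⊆?_)

IsPSCA : (n k l : ℕ) → List (Permutation′ n) → Set
IsPSCA n k l P = ∀ (y : List (Fin n)) → IsKSeq n k y → coverCount P y ≡ l

PSCAExists : (n k l : ℕ) → Set
PSCAExists n k l = Σ (List (Permutation′ n)) (IsPSCA n k l)

IsG : (n k g : ℕ) → Set
IsG n k g = (0 < g) × PSCAExists n k g × (∀ l → 0 < l → PSCAExists n k l → g ≤ l)

-- The union of a PSCA(n,k,a) and a PSCA(n,k,b) is a PSCA(n,k,a+b), so the set of
-- admissible λ is closed under addition. Adding g repeatedly to the window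
-- g, …, 2g−1 reaches every λ ≥ g, and minimality of g rules out smaller λ > 0.
module Submission where

open import Defs
open import Data.Nat using (ℕ; suc; _<_; _≤_; _+_; _∸_; _<?_)
open import Data.Nat.Properties
  using (m+[n∸m]≡n; m+n∸m≡n; ∸-monoˡ-≤; ∸-monoʳ-<; ≤-trans; m≤m+n; ≮⇒≥; m≤n⇒m≤1+n)
open import Data.Nat.Induction using (<-rec)
open import Data.Product using (_×_; _,_)
open import Function.Bundles using (_⇔_; mk⇔)
open import Data.Fin using (Fin)
open import Data.Fin.Permutation using (Permutation′)
open import Data.List using (List; _++_; filter; length)
open import Data.List.Properties using (filter-++; length-++)
open import Relation.Nullary using (yes; no)
open import Relation.Binary.PropositionalEquality using (_≡_; trans; cong; cong₂; subst)

coverCount-++ : ∀ {n} (P Q : List (Permutation′ n)) (y : List (Fin n)) →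
  coverCount (P ++ Q) y ≡ coverCount P y + coverCount Q y
coverCount-++ P Q y = trans (cong length (filter-++ _ P Q)) (length-++ (filter _ P))

PSCAExists-+ : ∀ {n k a b} → PSCAExists n k a → PSCAExists n k b → PSCAExists n k (a + b)
PSCAExists-+ (P , isP) (Q , isQ) =
  P ++ Q , λ y ky → trans (coverCount-++ P Q y) (cong₂ _+_ (isP y ky) (isQ y ky))

≥-from-window : ∀ {p} (E : ℕ → Set p) {g : ℕ} → 0 < g →
  (∀ {l} → E l → E (g + l)) →
  (∀ l → g ≤ l → l < g + g → E l) →
  ∀ l → g ≤ l → E l
≥-from-window E {g} g>0 shift window = <-rec _ step
  where
  step : ∀ l → (∀ {m} → m < l → g ≤ m → E m) → g ≤ l → E l
  step l rec g≤l with l <? g + g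
  ... | yes l<2g = window l g≤l l<2g
  ... | no l≮2g = subst E (m+[n∸m]≡n g≤l) (shift (rec l∸g<l g≤l∸g))
    where
    2g≤l : g + g ≤ l
    2g≤l = ≮⇒≥ l≮2g
    g≤l∸g : g ≤ l ∸ g
    g≤l∸g = subst (_≤ l ∸ g) (m+n∸m≡n g g) (∸-monoˡ-≤ g 2g≤l)
    l∸g<l : l ∸ g < l
    l∸g<l = ∸-monoʳ-< g>0 (≤-trans (m≤m+n g g) 2g≤l)

lemma4p8 : (n k : ℕ) → 2 ≤ k → k ≤ n → (g : ℕ) → IsG n k g →
    (∀ l → g ≤ l → l < g + g → PSCAExists n k l) →
    (∀ l → 0 < l → (PSCAExists n k l ⇔ g ≤ l)) ×
    (∀ l → 0 < l → PSCAExists n k l → PSCAExists n k (suc l))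
lemma4p8 n k _ _ g (g>0 , psca-g , g-minimal) window = characterisation , successor
  where
  exists-above-g : ∀ l → g ≤ l → PSCAExists n k l
  exists-above-g = ≥-from-window (PSCAExists n k) g>0 (PSCAExists-+ psca-g) window

  characterisation : ∀ l → 0 < l → (PSCAExists n k l ⇔ g ≤ l)
  characterisation l l>0 = mk⇔ (g-minimal l l>0) (exists-above-g l)

  successor : ∀ l → 0 < l → PSCAExists n k l → PSCAExists n k (suc l)
  successor l l>0 psca-l = exists-above-g (suc l) (m≤n⇒m≤1+n (g-minimal l l>0 psca-l))
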